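{- Let $\alpha\in(0,1)$ be irrational with bounded partial quotients, and let $s_\alpha$ be a Sturmian word of angle $\alpha$. Then there exists a constant $C>0$ such that for every integer $n\ge2$, $\sum_{m\le n}\mathrm{as}_{s_\alpha}(m)\ge Cn^2$, where $\mathrm{as}_{s_\alpha}(m)$ is the number of distinct factors of $s_\alpha$ of length $m$ that are abelian squares.
   Context: $\{x\}=x-\lfloor x\rfloor$. For $\alpha\in(0,1)$ irrational and $\rho\in[0,1)$, the Sturmian word $s_{\alpha,\rho}=a_0a_1\cdots$ over $\{a,b\}$ has $a_m=b$ if $\{\rho+m\alpha\}\in[0,1-\alpha)$ and $a_m=a$ otherwise (or the variant with intervals $(0,1-\alpha]$ and $(1-\alpha,1]$); its set of factors depends only on $\alpha$, and any such word is a Sturmian word of angle $\alpha$. An abelian square is a nonempty word $uv$ where $v$ is an anagram of $u$. $\alpha=[a_0;a_1,\ldots]$ has bounded partial quotients if $(a_i)$ is bounded. -}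

module Defs where

open import Data.Nat using (ℕ; zero; suc; _+_; _*_; _≤_; _<_)
open import Data.Product using (Σ; ∃; ∃-syntax; _×_; _,_)
open import Data.Sum using (_⊎_)
open import Data.List using (List; []; _++_; length; lookup)
open import Data.Fin using (Fin; toℕ)
open import Relation.Binary.PropositionalEquality using (_≡_; _≢_)
open import Data.List.Relation.Binary.Permutation.Propositional using (_↭_)

data Letter : Set where
  a b : Letter

-- An irrational α ∈ (0,1) is given by its (infinite, unique) continued
-- fraction expansion α = [0; a₁, a₂, …], with every aᵢ ≥ 1.
-- We encode it by  pq : ℕ → ℕ  with  pq i = a_{i+1}.
ValidCF : (ℕ → ℕ) → Set
ValidCF pq = ∀ i → 1 ≤ pq i

BoundedPQ : (ℕ → ℕ) → Set
BoundedPQ pq = ∃[ K ] (∀ i → pq i ≤ K)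

-- Numerators / denominators of the convergents, shifted by one:
-- P (j+1) / Q (j+1) = p_j / q_j ,  P 0 = p_{-1} = 1, Q 0 = q_{-1} = 0.
P : (ℕ → ℕ) → ℕ → ℕ
P pq zero = 1
P pq (suc zero) = 0
P pq (suc (suc j)) = pq j * P pq (suc j) + P pq j

Q : (ℕ → ℕ) → ℕ → ℕ
Q pq zero = 0
Q pq (suc zero) = 1
Q pq (suc (suc j)) = pq j * Q pq (suc j) + Q pq j

-- t / k < α  (for k ≥ 1): some even convergent p_{2i}/q_{2i} exceeds t/k
-- (even convergents increase strictly to α).
-- "t ≤ k·α" is then:  t = 0, or  t/k < α (α irrational).
LeKα : (ℕ → ℕ) → ℕ → ℕ → Set
LeKα pq t k = t ≡ 0 ⊎ ∃[ i ] (t * Q pq (suc (2 * i)) < k * P pq (suc (2 * i)))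

-- k·α < t  : some odd convergent p_{2i+1}/q_{2i+1} is below t/k
-- (odd convergents decrease strictly to α).
LtKα' : (ℕ → ℕ) → ℕ → ℕ → Set
LtKα' pq k t = ∃[ i ] (k * P pq (suc (suc (2 * i))) < t * Q pq (suc (suc (2 * i))))

Floor : (ℕ → ℕ) → ℕ → ℕ → Set
Floor pq k t = LeKα pq t k × LtKα' pq k (suc t)

-- The Sturmian word s_{α,0} = x₀ x₁ … : x_m = b iff {mα} ∈ [0, 1-α),
-- i.e. iff ⌊(m+1)α⌋ = ⌊mα⌋; otherwise x_m = a (⌊(m+1)α⌋ = ⌊mα⌋ + 1).
LetterAt : (ℕ → ℕ) → ℕ → Letter → Set
LetterAt pq m x =
  (x ≡ b × ∃[ t ] (Floor pq m t × Floor pq (suc m) t))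
  ⊎ (x ≡ a × ∃[ t ] (Floor pq m t × Floor pq (suc m) (suc t)))

IsFactor : (ℕ → ℕ) → List Letter → Set
IsFactor pq w = ∃[ i ] (∀ (k : Fin (length w)) → LetterAt pq (i + toℕ k) (lookup w k))

AbelianSquare : List Letter → Set
AbelianSquare w = ∃[ u ] ∃[ v ] (w ≡ u ++ v × u ≢ [] × v ↭ u)

{-# OPTIONS --safe #-}
module Submission where

-- Let p / q be an even convergent of α and q′ the denominator two convergents earlier, with
-- 3 q′ ≤ n < 3 q. Up to position q + q″ (q″ the next denominator) the Sturmian word agrees with
-- the rotation word of p / q, whose letter at y is a exactly when adding p to the residue
-- res y = y p mod q wraps around q. The factor of length 2 m at i is then an abelian square as soon as
-- res i + 2 res m < q, both halves containing ⌊m p / q⌋ letters a. Stepping by q′ and by the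
-- denominator between them moves residues by a and by −1, so the residues of any q′ consecutive
-- positions leave no gap longer than a b + a ≤ K² + K (a, b consecutive partial quotients).
-- Taking i among the last q′ positions below q and m in a range of length q′, with res i and
-- res m in prescribed windows of width G = K² + K + 1 inside [0 , q / 3), gives about
-- (q / 3 G)² ≥ (n / 9 G)² abelian squares of length at most 3 q′ ≤ n. They are distinct since
-- a factor reaching position q determines the residue of its start. For small n one factor aa
-- or bb suffices.

open import Data.Fin using (Fin; toℕ)
open import Data.Fin.Properties using (toℕ<n; toℕ-injective)
open import Data.List
  using (List; []; _∷_; _++_; length; take; replicate; lookup; map; cartesianProductWith; allFin)
open import Data.List.Properties using (length-++; length-map; length-tabulate)
open import Data.List.Relation.Binary.Permutation.Propositional
  using (_↭_; prep; ↭-refl; ↭-sym; ↭-trans; ↭-reflexive)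
open import Data.List.Relation.Binary.Permutation.Propositional.Properties using (shift)
open import Data.List.Relation.Unary.All using (All)
import Data.List.Relation.Unary.All.Properties as Allₚ
open import Data.List.Relation.Unary.AllPairs using (AllPairs)
open import Data.List.Relation.Unary.Unique.Propositional using (Unique)
import Data.List.Relation.Unary.Unique.Propositional.Properties as Uniqueₚ
open import Data.Nat
open import Data.Nat.DivMod
open import Data.Nat.Divisibility
  using (_∣_; n∣m*n; ∣-refl; ∣m∣n⇒∣m+n; ∣m+n∣m⇒∣n; ∣n⇒∣m*n; ∣1⇒≡1)
open import Data.Nat.Properties
open import Algebra.Properties.CommutativeSemigroup +-commutativeSemigroup
  using (x∙yz≈yx∙z; x∙yz≈y∙xz; xy∙z≈xz∙y; xy∙z≈y∙xz; interchange)
open import Data.Nat.Tactic.RingSolver using (solve)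
open import Data.Product using (∃-syntax; _×_; _,_; proj₁; proj₂)
open import Data.Sum using (_⊎_; inj₁; inj₂)
open import Function using (id)
open import Relation.Binary.PropositionalEquality
open import Relation.Nullary using (¬_; Dec; yes; no; contradiction)
open import Relation.Unary using (Decidable)

open import Defs

divMod-unique : ∀ {m n r} k .{{_ : NonZero n}} → r < n → m ≡ r + k * n → m / n ≡ k × m % n ≡ r
divMod-unique {n = n} {r} k r<n refl = quotient , remainder
  where
  quotient : (r + k * n) / n ≡ k
  quotient = begin
    (r + k * n) / n   ≡⟨ +-distrib-/-∣ʳ r (n∣m*n k) ⟩
    r / n + k * n / n ≡⟨ cong₂ _+_ (m<n⇒m/n≡0 r<n) (m*n/n≡m k n) ⟩
    k                 ∎
    where open ≡-Reasoning
  remainder : (r + k * n) % n ≡ r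
  remainder = trans ([m+kn]%n≡m%n r k n) (m<n⇒m%n≡m r<n)

k*n≤m<[1+k]*n⇒m/n≡k : ∀ {m n k} .{{_ : NonZero n}} → k * n ≤ m → m < suc k * n → m / n ≡ k
k*n≤m<[1+k]*n⇒m/n≡k {m} {n} {k} kn≤m m<n+kn = proj₁ (divMod-unique k offset<n (sym (m∸n+n≡m kn≤m)))
  where
  offset<n : m ∸ k * n < n
  offset<n = +-cancelʳ-< (k * n) (m ∸ k * n) n (subst (_< n + k * n) (sym (m∸n+n≡m kn≤m)) m<n+kn)

m<z+n∧m%n≡z⇒m≡z : ∀ {m n z} .{{_ : NonZero n}} → m < z + n → m % n ≡ z → m ≡ z
m<z+n∧m%n≡z⇒m≡z {m} {n} m<z+n refl with m / n | m≡m%n+[m/n]*n m n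
... | zero  | m≡z+0 = trans m≡z+0 (+-identityʳ (m % n))
... | suc k | m≡z+n+kn = contradiction m<z+n (≤⇒≯ (begin
  m % n + n         ≤⟨ +-monoʳ-≤ (m % n) (m≤m+n n (k * n)) ⟩
  m % n + suc k * n ≡⟨ m≡z+n+kn ⟨
  m                 ∎))
  where open ≤-Reasoning

m<suc[m/n]*n : ∀ m n .{{_ : NonZero n}} → m < suc (m / n) * n
m<suc[m/n]*n m n = begin-strict
  m                 ≡⟨ m≡m%n+[m/n]*n m n ⟩
  m % n + m / n * n <⟨ +-monoˡ-< (m / n * n) (m%n<n m n) ⟩
  n + m / n * n     ∎
  where open ≤-Reasoning

m+d≡f*n⇒m≡x+[f∸1]*n : ∀ m x d n f → x + d ≡ n → 0 < d → m + d ≡ f * n → m ≡ x + (f ∸ 1) * n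
m+d≡f*n⇒m≡x+[f∸1]*n m x d n zero _ 0<d m+d≡0 = contradiction (sym (m+n≡0⇒n≡0 m m+d≡0)) (<⇒≢ 0<d)
m+d≡f*n⇒m≡x+[f∸1]*n m x d .(x + d) (suc f) refl _ eq =
  +-cancelʳ-≡ d m (x + f * (x + d)) (trans eq (solve (x ∷ d ∷ f ∷ [])))

x*2≡x+x : ∀ x → x * 2 ≡ x + x
x*2≡x+x x = trans (*-comm x 2) (cong (x +_) (+-identityʳ x))

n/2+n/2≤n : ∀ n → n / 2 + n / 2 ≤ n
n/2+n/2≤n n = subst (_≤ n) (x*2≡x+x (n / 2)) (m/n*n≤m n 2)

n≤1+n/2+n/2 : ∀ n → n ≤ suc (n / 2 + n / 2)
n≤1+n/2+n/2 n = begin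
  n                   ≡⟨ m≡m%n+[m/n]*n n 2 ⟩
  n % 2 + n / 2 * 2   ≤⟨ +-monoˡ-≤ (n / 2 * 2) (≤-pred (m%n<n n 2)) ⟩
  1 + n / 2 * 2       ≡⟨ cong suc (x*2≡x+x (n / 2)) ⟩
  suc (n / 2 + n / 2) ∎
  where open ≤-Reasoning

m+m≡n+n⇒m≡n : ∀ {m n} → m + m ≡ n + n → m ≡ n
m+m≡n+n⇒m≡n {m} {n} eq = *-cancelˡ-≡ m n 2 (begin
  2 * m ≡⟨ cong (m +_) (+-identityʳ m) ⟩
  m + m ≡⟨ eq ⟩
  n + n ≡⟨ cong (n +_) (+-identityʳ n) ⟨
  2 * n ∎)
  where open ≡-Reasoning

*-cross-<-trans : ∀ t y u v w z → 0 < y → t * v ≤ y * u → u * z < w * v → t * z < y * w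
*-cross-<-trans t y@(suc _) u v w z _ tv≤yu uz<wv = *-cancelʳ-< v (t * z) (y * w) (begin-strict
  t * z * v   ≡⟨ solve (t ∷ z ∷ v ∷ []) ⟩
  t * v * z   ≤⟨ *-monoˡ-≤ z tv≤yu ⟩
  y * u * z   ≡⟨ *-assoc y u z ⟩
  y * (u * z) <⟨ *-monoʳ-< y uz<wv ⟩
  y * (w * v) ≡⟨ *-assoc y w v ⟨
  y * w * v   ∎)
  where open ≤-Reasoning

-- For Farey neighbours p₀ / q₀ < p₁ / q₁ no fraction with denominator y < q₀ + q₁ lies strictly
-- between them, so y p₁ / q₁ does not exceed ⌊y p₀ / q₀⌋ + 1.
farey-floor-bound : ∀ y t r p₀ q₀ p₁ q₁ → p₁ * q₀ ≡ p₀ * q₁ + 1 →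
                    y * p₀ ≡ r + t * q₀ → r < q₀ → y < q₀ + q₁ → y * p₁ ≤ suc t * q₁
farey-floor-bound y t r p₀ q₀ p₁ q₁ det y-div r<q₀ y< =
  ≤-pred (*-cancelʳ-< q₀ (y * p₁) (suc (suc t * q₁)) (begin-strict
    y * p₁ * q₀                  ≡⟨ *-assoc y p₁ q₀ ⟩
    y * (p₁ * q₀)                ≡⟨ cong (y *_) det ⟩
    y * (p₀ * q₁ + 1)            ≡⟨ solve (y ∷ p₀ ∷ q₁ ∷ []) ⟩
    y * p₀ * q₁ + y              ≡⟨ cong (λ z → z * q₁ + y) y-div ⟩
    (r + t * q₀) * q₁ + y        ≡⟨ solve (r ∷ t ∷ q₀ ∷ q₁ ∷ y ∷ []) ⟩
    t * q₁ * q₀ + (r * q₁ + y)   <⟨ +-monoʳ-< (t * q₁ * q₀) remainder-bound ⟩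
    t * q₁ * q₀ + (q₀ * q₁ + q₀) ≡⟨ solve (t ∷ q₀ ∷ q₁ ∷ []) ⟩
    suc (suc t * q₁) * q₀        ∎))
  where
  open ≤-Reasoning
  remainder-bound : r * q₁ + y < q₀ * q₁ + q₀
  remainder-bound = begin-strict
    r * q₁ + y         <⟨ +-monoʳ-< (r * q₁) y< ⟩
    r * q₁ + (q₀ + q₁) ≡⟨ solve (r ∷ q₀ ∷ q₁ ∷ []) ⟩
    suc r * q₁ + q₀    ≤⟨ +-monoˡ-≤ q₀ (*-monoˡ-≤ q₁ r<q₀) ⟩
    q₀ * q₁ + q₀       ∎

square-bound : ∀ n C T N → n < C * suc T → T * T ≤ N → 0 < N → n * n ≤ 4 * (C * C) * N
square-bound n C T N n<C[1+T] T²≤N 0<N = begin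
  n * n                   ≤⟨ *-mono-≤ (<⇒≤ n<C[1+T]) (<⇒≤ n<C[1+T]) ⟩
  C * suc T * (C * suc T) ≡⟨ solve (C ∷ T ∷ []) ⟩
  C * C * (suc T * suc T) ≤⟨ *-monoʳ-≤ (C * C) ([1+T]²≤4N T T²≤N) ⟩
  C * C * (4 * N)         ≡⟨ solve (C ∷ N ∷ []) ⟩
  4 * (C * C) * N         ∎
  where
  open ≤-Reasoning
  [1+T]²≤4N : ∀ T → T * T ≤ N → suc T * suc T ≤ 4 * N
  [1+T]²≤4N zero     _    = ≤-trans 0<N (m≤n*m N 4)
  [1+T]²≤4N (suc T′) T²≤N = begin
    suc (suc T′) * suc (suc T′)           ≤⟨ *-mono-≤ 2+T′≤2[1+T′] 2+T′≤2[1+T′] ⟩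
    (suc T′ + suc T′) * (suc T′ + suc T′) ≡⟨ solve (T′ ∷ []) ⟩
    4 * (suc T′ * suc T′)                 ≤⟨ *-monoʳ-≤ 4 T²≤N ⟩
    4 * N                                 ∎
    where
    2+T′≤2[1+T′] : suc (suc T′) ≤ suc T′ + suc T′
    2+T′≤2[1+T′] = s≤s (m≤n+m (suc T′) T′)

threshold : ∀ {P : ℕ → Set} → Decidable P → P 0 → ∀ N → ¬ P N → ∃[ s ] (P s × ¬ P (suc s))
threshold P? P0 zero    ¬PN = contradiction P0 ¬PN
threshold P? P0 (suc N) ¬PN with P? N
... | yes PN  = N , PN , ¬PN
... | no ¬PN′ = threshold P? P0 N ¬PN′

length-cartesianProductWith : ∀ {A B C : Set} (f : A → B → C) xs ys →
                              length (cartesianProductWith f xs ys) ≡ length xs * length ys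
length-cartesianProductWith f []       ys = refl
length-cartesianProductWith f (x ∷ xs) ys = begin
  length (map (f x) ys ++ cartesianProductWith f xs ys)         ≡⟨ length-++ (map (f x) ys) ⟩
  length (map (f x) ys) + length (cartesianProductWith f xs ys) ≡⟨ cong₂ _+_ (length-map (f x) ys)
                                                                            (length-cartesianProductWith f xs ys) ⟩
  length ys + length xs * length ys                             ∎
  where open ≡-Reasoning

#a #b : List Letter → ℕ
#a []      = 0
#a (a ∷ w) = suc (#a w)
#a (b ∷ w) = #a w
#b []      = 0
#b (a ∷ w) = #b w
#b (b ∷ w) = suc (#b w)

length≡#a+#b : ∀ w → length w ≡ #a w + #b w
length≡#a+#b []      = refl
length≡#a+#b (a ∷ w) = cong suc (length≡#a+#b w)
length≡#a+#b (b ∷ w) = trans (cong suc (length≡#a+#b w)) (sym (+-suc (#a w) (#b w)))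

sorted : List Letter → List Letter
sorted w = replicate (#a w) a ++ replicate (#b w) b

↭-sorted : ∀ w → w ↭ sorted w
↭-sorted []      = ↭-refl
↭-sorted (a ∷ w) = prep a (↭-sorted w)
↭-sorted (b ∷ w) = ↭-trans (prep b (↭-sorted w)) (↭-sym (shift b (replicate (#a w) a) (replicate (#b w) b)))

↭-of-#a : ∀ {u v} → length u ≡ length v → #a u ≡ #a v → u ↭ v
↭-of-#a {u} {v} |u|≡|v| #au≡#av = ↭-trans (↭-sorted u) (↭-trans same-sorted (↭-sym (↭-sorted v)))
  where
  #bu≡#bv : #b u ≡ #b v
  #bu≡#bv = +-cancelˡ-≡ (#a u) (#b u) (#b v) (begin
    #a u + #b u ≡⟨ length≡#a+#b u ⟨
    length u    ≡⟨ |u|≡|v| ⟩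
    length v    ≡⟨ length≡#a+#b v ⟩
    #a v + #b v ≡⟨ cong (_+ #b v) #au≡#av ⟨
    #a u + #b v ∎)
    where open ≡-Reasoning
  same-sorted : sorted u ↭ sorted v
  same-sorted = ↭-reflexive (cong₂ (λ i j → replicate i a ++ replicate j b) #au≡#av #bu≡#bv)

abelianSquare-++ : ∀ {u v} → u ≢ [] → length u ≡ length v → #a u ≡ #a v → AbelianSquare (u ++ v)
abelianSquare-++ {u} {v} u≢[] |u|≡|v| #au≡#av = u , v , refl , u≢[] , ↭-of-#a (sym |u|≡|v|) (sym #au≡#av)

abelianSquare-xx : ∀ x → AbelianSquare (x ∷ x ∷ [])
abelianSquare-xx x = x ∷ [] , x ∷ [] , refl , (λ ()) , ↭-refl

-- The columns (u , v) and (w , z) have determinant u z − w v = 1. Replacing one column by itself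
-- plus k times the other keeps the determinant; replacing it by k times itself plus the other
-- multiplies the determinant by k.
module Unimodular {u v w z : ℕ} (k : ℕ) (det : u * z ≡ w * v + 1) where
  open ≡-Reasoning

  stepˡ : (k * w + u) * z ≡ w * (k * z + v) + 1
  stepˡ = begin
    (k * w + u) * z         ≡⟨ solve (k ∷ w ∷ u ∷ z ∷ []) ⟩
    k * w * z + u * z       ≡⟨ cong (k * w * z +_) det ⟩
    k * w * z + (w * v + 1) ≡⟨ solve (k ∷ w ∷ z ∷ v ∷ []) ⟩
    w * (k * z + v) + 1     ∎

  stepʳ : u * (k * v + z) ≡ (k * u + w) * v + 1
  stepʳ = begin
    u * (k * v + z)         ≡⟨ solve (u ∷ k ∷ v ∷ z ∷ []) ⟩
    k * u * v + u * z       ≡⟨ cong (k * u * v +_) det ⟩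
    k * u * v + (w * v + 1) ≡⟨ solve (k ∷ u ∷ v ∷ w ∷ []) ⟩
    (k * u + w) * v + 1     ∎

  jumpˡ : (k * u + w) * z ≡ w * (k * v + z) + k
  jumpˡ = begin
    (k * u + w) * z         ≡⟨ solve (k ∷ u ∷ w ∷ z ∷ []) ⟩
    k * (u * z) + w * z     ≡⟨ cong (λ t → k * t + w * z) det ⟩
    k * (w * v + 1) + w * z ≡⟨ solve (k ∷ w ∷ v ∷ z ∷ []) ⟩
    w * (k * v + z) + k     ∎

  jumpʳ : u * (k * z + v) ≡ (k * w + u) * v + k
  jumpʳ = begin
    u * (k * z + v)         ≡⟨ solve (u ∷ k ∷ z ∷ v ∷ []) ⟩
    k * (u * z) + u * v     ≡⟨ cong (λ t → k * t + u * v) det ⟩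
    k * (w * v + 1) + u * v ≡⟨ solve (k ∷ w ∷ v ∷ u ∷ []) ⟩
    (k * w + u) * v + k     ∎

module Convergents (pq : ℕ → ℕ) (valid : ValidCF pq) where

  p q : ℕ → ℕ
  p = P pq
  q = Q pq

  -- p (even j) / q (even j) and p (odd j) / q (odd j) are the convergents of index 2 j and 2 j + 1.
  even odd : ℕ → ℕ
  even j = suc (2 * j)
  odd j = suc (suc (2 * j))

  instance
    pq-nonZero : ∀ {n} → NonZero (pq n)
    pq-nonZero {n} = >-nonZero (valid n)

  q-mono : ∀ n → q n ≤ q (suc n)
  q-mono zero    = z≤n
  q-mono (suc n) = ≤-trans (m≤n*m (q (suc n)) (pq n)) (m≤m+n _ (q n))

  q-pos : ∀ n → 0 < q (suc n)
  q-pos zero    = ≤-refl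
  q-pos (suc n) = ≤-trans (q-pos n) (q-mono (suc n))

  q-+ : ∀ n → q (suc n) + q n ≤ q (suc (suc n))
  q-+ n = +-monoˡ-≤ (q n) (m≤n*m (q (suc n)) (pq n))

  q-rec-bound : ∀ n → q (suc (suc n)) ≤ suc (pq n) * q (suc n)
  q-rec-bound n = begin
    pq n * q (suc n) + q n       ≤⟨ +-monoʳ-≤ (pq n * q (suc n)) (q-mono n) ⟩
    pq n * q (suc n) + q (suc n) ≡⟨ +-comm (pq n * q (suc n)) (q (suc n)) ⟩
    suc (pq n) * q (suc n)       ∎
    where open ≤-Reasoning

  q-grows : ∀ n → n ≤ q (suc n)
  q-grows zero          = z≤n
  q-grows (suc zero)    = q-pos 1
  q-grows (suc (suc n)) = ≤-trans (subst (_≤ q (suc (suc n)) + q (suc n)) (+-comm (suc n) 1)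
    (+-mono-≤ (q-grows (suc n)) (q-pos n))) (q-+ (suc n))

  p≤q : ∀ n → p (suc n) ≤ q (suc n)
  p≤q n = proj₁ (both n)
    where
    both : ∀ n → p (suc n) ≤ q (suc n) × p (suc (suc n)) ≤ q (suc (suc n))
    both zero    = z≤n , (begin
      pq 0 * 0 + 1 ≡⟨ cong (_+ 1) (*-zeroʳ (pq 0)) ⟩
      1            ≤⟨ valid 0 ⟩
      pq 0         ≡⟨ trans (+-identityʳ _) (*-identityʳ (pq 0)) ⟨
      pq 0 * 1 + 0 ∎)
      where open ≤-Reasoning
    both (suc n) = let p≤q₁ , p≤q₂ = both n in p≤q₂ , +-mono-≤ (*-monoʳ-≤ (pq (suc n)) p≤q₂) p≤q₁

  Det : ℕ → ℕ → Set
  Det m n = p m * q n ≡ p n * q m + 1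

  det-even : ∀ j → Det (2 * j) (even j)
  det-odd  : ∀ j → Det (odd j) (even j)
  det-even zero    = refl
  det-even (suc j) = subst (λ n → Det n (suc n)) (sym (*-suc 2 j)) (Unimodular.stepʳ (pq (even j)) (det-odd j))
  det-odd j = Unimodular.stepˡ (pq (2 * j)) (det-even j)

  det-jump-even : ∀ j → p (even (suc j)) * q (even j) ≡ p (even j) * q (even (suc j)) + pq (even j)
  det-jump-even j = subst (λ n → p (suc n) * q (even j) ≡ p (even j) * q (suc n) + pq (even j)) (sym (*-suc 2 j))
    (Unimodular.jumpˡ (pq (even j)) (det-odd j))

  det-jump-odd : ∀ j → p (odd j) * q (odd (suc j)) ≡ p (odd (suc j)) * q (odd j) + pq (odd j)
  det-jump-odd j = subst (λ n → p (odd j) * q (suc (suc n)) ≡ p (suc (suc n)) * q (odd j) + pq (odd j))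
    (sym (*-suc 2 j))
    (Unimodular.jumpʳ (pq (odd j)) (Unimodular.stepʳ (pq (even j)) (det-odd j)))

  even-convergents-increase : ∀ j → p (even j) * q (even (suc j)) < p (even (suc j)) * q (even j)
  even-convergents-increase j =
    subst (p (even j) * q (even (suc j)) <_) (sym (det-jump-even j)) (m<m+n _ (valid (even j)))

  odd-convergents-decrease : ∀ j → p (odd (suc j)) * q (odd j) < p (odd j) * q (odd (suc j))
  odd-convergents-decrease j =
    subst (p (odd (suc j)) * q (odd j) <_) (sym (det-jump-odd j)) (m<m+n _ (valid (odd j)))

  LeKα-from-convergent : ∀ j y t → t * q (even j) ≤ y * p (even j) → LeKα pq t y
  LeKα-from-convergent j zero t tq≤0 =
    inj₁ (m*n≡0⇒m≡0 t (q (even j)) {{>-nonZero (q-pos (2 * j))}} (n≤0⇒n≡0 tq≤0))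
  LeKα-from-convergent j (suc y) t tq≤yp = inj₂ (suc j ,
    *-cross-<-trans t (suc y) (p (even j)) (q (even j)) (p (even (suc j))) (q (even (suc j)))
      z<s tq≤yp (even-convergents-increase j))

  LtKα'-from-convergent : ∀ j y u → 0 < u → y * p (odd j) ≤ u * q (odd j) → LtKα' pq y u
  LtKα'-from-convergent j y u 0<u yp≤uq = suc j ,
    *-cross-<-trans y u (q (odd j)) (p (odd j)) (q (odd (suc j))) (p (odd (suc j))) 0<u yp≤uq
      (subst₂ _<_ (*-comm (p (odd (suc j))) (q (odd j))) (*-comm (p (odd j)) (q (odd (suc j))))
        (odd-convergents-decrease j))

  floor-from-convergent : ∀ j y t r → y * p (even j) ≡ r + t * q (even j) → r < q (even j) →
                          y < q (even j) + q (odd j) → Floor pq y t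
  floor-from-convergent j y t r y-div r<q y< =
      LeKα-from-convergent j y t (subst (t * q (even j) ≤_) (sym y-div) (m≤n+m (t * q (even j)) r))
    , LtKα'-from-convergent j y (suc t) z<s
        (farey-floor-bound y t r (p (even j)) (q (even j)) (p (odd j)) (q (odd j)) (det-odd j) y-div r<q y<)

module Rotation (p q : ℕ) .{{_ : NonZero q}} (p≤q : p ≤ q) where

  quot res : ℕ → ℕ
  quot y = y * p / q
  res y = y * p % q

  division : ∀ y → y * p ≡ res y + quot y * q
  division y = m≡m%n+[m/n]*n (y * p) q

  res<q : ∀ y → res y < q
  res<q y = m%n<n (y * p) q

  letter : ℕ → Letter
  letter y with res y + p <? q
  ... | yes _ = b
  ... | no _  = a

  letter-b : ∀ y → res y + p < q → letter y ≡ b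
  letter-b y no-carry with res y + p <? q
  ... | yes _    = refl
  ... | no carry = contradiction no-carry carry

  letter-a : ∀ y → q ≤ res y + p → letter y ≡ a
  letter-a y carry with res y + p <? q
  ... | yes no-carry = contradiction carry (<⇒≱ no-carry)
  ... | no _         = refl

  division-suc : ∀ y → suc y * p ≡ (res y + p) + quot y * q
  division-suc y = begin
    p + y * p                ≡⟨ cong (p +_) (division y) ⟩
    p + (res y + quot y * q) ≡⟨ x∙yz≈yx∙z p (res y) (quot y * q) ⟩
    res y + p + quot y * q   ∎
    where open ≡-Reasoning

  carry-suc : ∀ y → q ≤ res y + p → quot (suc y) ≡ suc (quot y) × res (suc y) ≡ res y + p ∸ q
  carry-suc y carry = divMod-unique (suc (quot y)) wrapped<q (begin
    suc y * p                          ≡⟨ division-suc y ⟩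
    res y + p + quot y * q             ≡⟨ cong (_+ quot y * q) (m+[n∸m]≡n carry) ⟨
    q + (res y + p ∸ q) + quot y * q   ≡⟨ cong (_+ quot y * q) (+-comm q _) ⟩
    (res y + p ∸ q) + q + quot y * q   ≡⟨ +-assoc (res y + p ∸ q) q (quot y * q) ⟩
    (res y + p ∸ q) + suc (quot y) * q ∎)
    where
    open ≡-Reasoning
    wrapped<q : res y + p ∸ q < q
    wrapped<q = +-cancelˡ-< q (res y + p ∸ q) q
      (subst (_< q + q) (sym (m+[n∸m]≡n carry)) (+-mono-<-≤ (res<q y) p≤q))

  quot-suc : ∀ y → (letter y ≡ b × quot (suc y) ≡ quot y) ⊎ (letter y ≡ a × quot (suc y) ≡ suc (quot y))
  quot-suc y with res y + p <? q
  ... | yes no-carry = inj₁ (refl , proj₁ (divMod-unique (quot y) no-carry (division-suc y)))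
  ... | no carry     = inj₂ (refl , proj₁ (carry-suc y (≮⇒≥ carry)))

  factor : ℕ → ℕ → List Letter
  factor i zero    = []
  factor i (suc L) = letter i ∷ factor (suc i) L

  length-factor : ∀ i L → length (factor i L) ≡ L
  length-factor i zero    = refl
  length-factor i (suc L) = cong suc (length-factor (suc i) L)

  factor-+ : ∀ i m n → factor i (m + n) ≡ factor i m ++ factor (i + m) n
  factor-+ i zero    n = cong (λ j → factor j n) (sym (+-identityʳ i))
  factor-+ i (suc m) n = cong (letter i ∷_)
    (trans (factor-+ (suc i) m n) (cong (λ j → factor (suc i) m ++ factor j n) (sym (+-suc i m))))

  take-factor : ∀ i {l L} → l ≤ L → take l (factor i L) ≡ factor i l
  take-factor i {zero}          _         = refl
  take-factor i {suc l} {suc L} (s≤s l≤L) = cong (letter i ∷_) (take-factor (suc i) l≤L)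

  #a-letter : ∀ i w → #a (letter i ∷ w) + quot i ≡ #a w + quot (suc i)
  #a-letter i w with letter i | quot-suc i
  ... | _ | inj₁ (refl , quot-same) = cong (#a w +_) (sym quot-same)
  ... | _ | inj₂ (refl , quot-step) = trans (sym (+-suc (#a w) (quot i))) (cong (#a w +_) (sym quot-step))

  #a-factor : ∀ i L → #a (factor i L) + quot i ≡ quot (i + L)
  #a-factor i zero    = cong quot (sym (+-identityʳ i))
  #a-factor i (suc L) = begin
    #a (letter i ∷ factor (suc i) L) + quot i ≡⟨ #a-letter i (factor (suc i) L) ⟩
    #a (factor (suc i) L) + quot (suc i)     ≡⟨ #a-factor (suc i) L ⟩
    quot (suc i + L)                         ≡⟨ cong quot (+-suc i L) ⟨
    quot (i + suc L)                         ∎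
    where open ≡-Reasoning

  quot-+ : ∀ x y → res x + res y < q → quot (x + y) ≡ quot x + quot y
  quot-+ x y no-carry = trans (cong (_/ q) (*-distribʳ-+ p x y)) (+-distrib-/ (x * p) (y * p) no-carry)

  res-+ : ∀ x y → res x + res y < q → res (x + y) ≡ res x + res y
  res-+ x y no-carry = begin
    (x + y) * p % q     ≡⟨ cong (_% q) (*-distribʳ-+ p x y) ⟩
    (x * p + y * p) % q ≡⟨ %-distribˡ-+ (x * p) (y * p) q ⟩
    (res x + res y) % q ≡⟨ m<n⇒m%n≡m no-carry ⟩
    res x + res y       ∎
    where open ≡-Reasoning

  #a-factor-no-carry : ∀ i m → res i + res m < q → #a (factor i m) ≡ quot m
  #a-factor-no-carry i m no-carry = +-cancelʳ-≡ (quot i) (#a (factor i m)) (quot m)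
    (trans (#a-factor i m) (trans (quot-+ i m no-carry) (+-comm (quot i) (quot m))))

  factor-abelianSquare : ∀ i m → 0 < m → res i + (res m + res m) < q → AbelianSquare (factor i (m + m))
  factor-abelianSquare i m@(suc _) _ no-carry = subst AbelianSquare (sym (factor-+ i m m))
    (abelianSquare-++ (λ ()) (trans (length-factor i m) (sym (length-factor (i + m) m)))
      (trans (#a-factor-no-carry i m first-half) (sym (#a-factor-no-carry (i + m) m second-half))))
    where
    first-half : res i + res m < q
    first-half = ≤-<-trans (+-monoʳ-≤ (res i) (m≤m+n (res m) (res m))) no-carry
    second-half : res (i + m) + res m < q
    second-half = subst (λ r → r + res m < q) (sym (res-+ i m first-half))
      (subst (_< q) (sym (+-assoc (res i) (res m) (res m))) no-carry)

  res-q : res q ≡ 0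
  res-q = trans (cong (_% q) (*-comm q p)) (m*n%n≡0 p q)

  res-balance : ∀ i j l → quot (i + l) + quot j ≡ quot i + quot (j + l) →
                res (i + l) + res j ≡ res i + res (j + l)
  res-balance i j l quot-balance = +-cancelʳ-≡ ((quot (i + l) + quot j) * q) _ _ (begin
    res (i + l) + res j + (quot (i + l) + quot j) * q     ≡⟨ regroup (res (i + l)) (res j) (quot (i + l)) (quot j) ⟩
    res (i + l) + quot (i + l) * q + (res j + quot j * q) ≡⟨ cong₂ _+_ (division (i + l)) (division j) ⟨
    (i + l) * p + j * p                                   ≡⟨ solve (i ∷ l ∷ j ∷ p ∷ []) ⟩
    i * p + (j + l) * p                                   ≡⟨ cong₂ _+_ (division i) (division (j + l)) ⟩
    res i + quot i * q + (res (j + l) + quot (j + l) * q) ≡⟨ regroup (res i) (res (j + l)) (quot i) (quot (j + l)) ⟨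
    res i + res (j + l) + (quot i + quot (j + l)) * q     ≡⟨ cong (λ f → res i + res (j + l) + f * q) quot-balance ⟨
    res i + res (j + l) + (quot (i + l) + quot j) * q     ∎)
    where
    open ≡-Reasoning
    regroup : ∀ r s f g → r + s + (f + g) * q ≡ r + f * q + (s + g * q)
    regroup r s f g = solve (r ∷ s ∷ f ∷ g ∷ q ∷ [])

  -- The prefixes of length q ∸ j agree; counting their letters a shows res j ≤ res i.
  factor-≡⇒res-≤ : ∀ i j L → j < q → q ≤ j + L → factor i L ≡ factor j L → res j ≤ res i
  factor-≡⇒res-≤ i j L j<q q≤j+L same = begin
    res j               ≤⟨ m≤n+m (res j) (res (i + l)) ⟩
    res (i + l) + res j ≡⟨ res-balance i j l quot-balance ⟩
    res i + res (j + l) ≡⟨ cong (λ k → res i + res k) j+l≡q ⟩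
    res i + res q       ≡⟨ cong (res i +_) res-q ⟩
    res i + 0           ≡⟨ +-identityʳ (res i) ⟩
    res i               ∎
    where
    open ≤-Reasoning
    l = q ∸ j
    j+l≡q : j + l ≡ q
    j+l≡q = m+[n∸m]≡n (<⇒≤ j<q)
    l≤L : l ≤ L
    l≤L = m≤n+o⇒m∸n≤o q j q≤j+L
    same-prefix : factor i l ≡ factor j l
    same-prefix = trans (sym (take-factor i l≤L)) (trans (cong (take l) same) (take-factor j l≤L))
    quot-balance : quot (i + l) + quot j ≡ quot i + quot (j + l)
    quot-balance = begin-equality
      quot (i + l) + quot j               ≡⟨ cong (_+ quot j) (#a-factor i l) ⟨
      #a (factor i l) + quot i + quot j   ≡⟨ cong (λ w → #a w + quot i + quot j) same-prefix ⟩
      #a (factor j l) + quot i + quot j   ≡⟨ xy∙z≈y∙xz (#a (factor j l)) (quot i) (quot j) ⟩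
      quot i + (#a (factor j l) + quot j) ≡⟨ cong (quot i +_) (#a-factor j l) ⟩
      quot i + quot (j + l)               ∎

  res-shift-down : ∀ y d c k → d * p + c ≡ k * q → (res (y + d) + c) % q ≡ res y
  res-shift-down y d c k shift = begin
    (res (y + d) + c) % q                    ≡⟨ [m+kn]%n≡m%n (res (y + d) + c) (quot (y + d)) q ⟨
    (res (y + d) + c + quot (y + d) * q) % q ≡⟨ cong (_% q) lift ⟩
    (y * p + k * q) % q                      ≡⟨ [m+kn]%n≡m%n (y * p) k q ⟩
    res y                                    ∎
    where
    open ≡-Reasoning
    lift : res (y + d) + c + quot (y + d) * q ≡ y * p + k * q
    lift = begin
      res (y + d) + c + quot (y + d) * q ≡⟨ xy∙z≈xz∙y (res (y + d)) c (quot (y + d) * q) ⟩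
      res (y + d) + quot (y + d) * q + c ≡⟨ cong (_+ c) (division (y + d)) ⟨
      (y + d) * p + c                    ≡⟨ cong (_+ c) (*-distribʳ-+ p y d) ⟩
      y * p + d * p + c                  ≡⟨ +-assoc (y * p) (d * p) c ⟩
      y * p + (d * p + c)                ≡⟨ cong (y * p +_) shift ⟩
      y * p + k * q                      ∎

  res-shift-up : ∀ y d c k → d * p ≡ c + k * q → res (y + d) ≡ (res y + c) % q
  res-shift-up y d c k shift = begin
    (y + d) * p % q                    ≡⟨ cong (_% q) lift ⟩
    (res y + c + (quot y + k) * q) % q ≡⟨ [m+kn]%n≡m%n (res y + c) (quot y + k) q ⟩
    (res y + c) % q                    ∎
    where
    open ≡-Reasoning
    lift : (y + d) * p ≡ res y + c + (quot y + k) * q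
    lift = begin
      (y + d) * p                      ≡⟨ *-distribʳ-+ p y d ⟩
      y * p + d * p                    ≡⟨ cong₂ _+_ (division y) shift ⟩
      res y + quot y * q + (c + k * q) ≡⟨ interchange (res y) (quot y * q) c (k * q) ⟩
      res y + c + (quot y * q + k * q) ≡⟨ cong (res y + c +_) (*-distribʳ-+ q (quot y) k) ⟨
      res y + c + (quot y + k) * q     ∎

  res-periodic : ∀ y k → res (y + k * q) ≡ res y
  res-periodic y k = begin
    res (y + k * q) ≡⟨ res-shift-up y (k * q) 0 (k * p) (solve (k ∷ q ∷ p ∷ [])) ⟩
    (res y + 0) % q ≡⟨ cong (_% q) (+-identityʳ (res y)) ⟩
    res y % q       ≡⟨ m%n%n≡m%n (y * p) q ⟩
    res y           ∎
    where open ≡-Reasoning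

  res+1≡q : ∀ R X → R * p + 1 ≡ X * q → res R + 1 ≡ q
  res+1≡q R X R-step = trans (cong (_+ 1) (proj₂ (divMod-unique (X ∸ 1) q∸1<q R-div))) q∸1+1≡q
    where
    q∸1+1≡q : q ∸ 1 + 1 ≡ q
    q∸1+1≡q = m∸n+n≡m (>-nonZero⁻¹ q)
    q∸1<q : q ∸ 1 < q
    q∸1<q = subst (q ∸ 1 <_) q∸1+1≡q (m<m+n (q ∸ 1) z<s)
    R-div : R * p ≡ q ∸ 1 + (X ∸ 1) * q
    R-div = m+d≡f*n⇒m≡x+[f∸1]*n (R * p) (q ∸ 1) 1 q X q∸1+1≡q z<s R-step

  q≢p+p : ∀ R X → R * p + 1 ≡ X * q → 3 ≤ q → q ≢ p + p
  q≢p+p R X R-step 3≤q q≡p+p = <⇒≱ 3≤q (subst (_≤ 2) (sym q≡p+p) (+-mono-≤ p≤1 p≤1))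
    where
    p∣Rp+1 : p ∣ R * p + 1
    p∣Rp+1 = subst (p ∣_) (sym (trans R-step (cong (X *_) q≡p+p)))
      (∣n⇒∣m*n X (∣m∣n⇒∣m+n ∣-refl ∣-refl))
    p≤1 : p ≤ 1
    p≤1 = ≤-reflexive (∣1⇒≡1 (∣m+n∣m⇒∣n p∣Rp+1 (n∣m*n R)))

  factor-bb : p + p < q → factor 0 2 ≡ b ∷ b ∷ []
  factor-bb 2p<q = cong₂ (λ x y → x ∷ y ∷ [])
    (letter-b 0 (subst (λ r → r + p < q) (sym res-0) p<q)) (letter-b 1 (subst (λ r → r + p < q) (sym res-1) 2p<q))
    where
    p<q : p < q
    p<q = ≤-<-trans (m≤m+n p p) 2p<q
    res-0 : res 0 ≡ 0
    res-0 = m<n⇒m%n≡m (>-nonZero⁻¹ q)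
    res-1 : res 1 ≡ p
    res-1 = trans (cong (_% q) (*-identityˡ p)) (m<n⇒m%n≡m p<q)

  -- The residue q − 1 at R is followed by p − 1, and both carry when q < 2 p.
  factor-aa : ∀ R X → R * p + 1 ≡ X * q → q < p + p → factor R 2 ≡ a ∷ a ∷ []
  factor-aa R X R-step q<2p = cong₂ (λ x y → x ∷ y ∷ []) (letter-a R carry-R) (letter-a (suc R) carry-R+1)
    where
    res-R : res R + 1 ≡ q
    res-R = res+1≡q R X R-step
    p≥1 : 1 ≤ p
    p≥1 = ≰⇒> (λ p≤0 → <⇒≱ (<-trans (>-nonZero⁻¹ q) q<2p) (+-mono-≤ p≤0 p≤0))
    carry-R : q ≤ res R + p
    carry-R = subst (_≤ res R + p) res-R (+-monoʳ-≤ (res R) p≥1)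
    res-R+1 : res (suc R) + 1 ≡ p
    res-R+1 = begin
      res (suc R) + 1             ≡⟨ cong (_+ 1) (proj₂ (carry-suc R carry-R)) ⟩
      res R + p ∸ q + 1           ≡⟨ cong (λ n → res R + p ∸ n + 1) res-R ⟨
      res R + p ∸ (res R + 1) + 1 ≡⟨ cong (_+ 1) ([m+n]∸[m+o]≡n∸o (res R) p 1) ⟩
      p ∸ 1 + 1                   ≡⟨ m∸n+n≡m p≥1 ⟩
      p                           ∎
      where open ≡-Reasoning
    carry-R+1 : q ≤ res (suc R) + p
    carry-R+1 = +-cancelʳ-≤ 1 q (res (suc R) + p) (begin
      q + 1               ≡⟨ +-comm q 1 ⟩
      suc q               ≤⟨ q<2p ⟩
      p + p               ≡⟨ cong (_+ p) res-R+1 ⟨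
      res (suc R) + 1 + p ≡⟨ xy∙z≈xz∙y (res (suc R)) 1 p ⟩
      res (suc R) + p + 1 ∎)
      where open ≤-Reasoning

  -- R steps lower the residue by 1 and S steps raise it by A (both mod q); q ≤ (A + 1) R and
  -- R ≤ (B + 1) S bound the number of steps of each kind needed to cover [0 , q).
  module Density (R S A B X Y : ℕ) .{{_ : NonZero R}} .{{_ : NonZero S}}
                 (R-step : R * p + 1 ≡ X * q) (S-step : S * p ≡ A + Y * q)
                 (q≤[1+A]R : q ≤ suc A * R) (R≤[1+B]S : R ≤ suc B * S) where

    res-down : ∀ y u → res (y + u * R) + u < q → res y ≡ res (y + u * R) + u
    res-down y u no-wrap = trans (sym (res-shift-down y (u * R) u (u * X) u-steps)) (m<n⇒m%n≡m no-wrap)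
      where
      u-steps : u * R * p + u ≡ u * X * q
      u-steps = begin
        u * R * p + u   ≡⟨ solve (u ∷ R ∷ p ∷ []) ⟩
        u * (R * p + 1) ≡⟨ cong (u *_) R-step ⟩
        u * (X * q)     ≡⟨ *-assoc u X q ⟨
        u * X * q       ∎
        where open ≡-Reasoning

    res-up : ∀ y u → u * A ≤ res (y + u * S) → res y + u * A ≡ res (y + u * S)
    res-up y u uA≤res = m<z+n∧m%n≡z⇒m≡z no-wrap (sym (res-shift-up y (u * S) (u * A) (u * Y) u-steps))
      where
      no-wrap : res y + u * A < res (y + u * S) + q
      no-wrap = subst (res y + u * A <_) (+-comm q (res (y + u * S))) (+-mono-<-≤ (res<q y) uA≤res)
      u-steps : u * S * p ≡ u * A + u * Y * q
      u-steps = begin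
        u * S * p         ≡⟨ *-assoc u S p ⟩
        u * (S * p)       ≡⟨ cong (u *_) S-step ⟩
        u * (A + Y * q)   ≡⟨ solve (u ∷ A ∷ Y ∷ q ∷ []) ⟩
        u * A + u * Y * q ∎
        where open ≡-Reasoning

    -- Starting from i, k = res i + (q ∸ x) steps of R move the residue down to x.
    res-surjective : ∀ i x → x < q → ∃[ w ] (w < q × res (i + w) ≡ x)
    res-surjective i x x<q = k * R % q , m%n<n (k * R) q , (begin
      res (i + k * R % q)                 ≡⟨ res-periodic (i + k * R % q) (k * R / q) ⟨
      res (i + k * R % q + k * R / q * q) ≡⟨ cong res (trans (+-assoc i _ _)
                                               (cong (i +_) (sym (m≡m%n+[m/n]*n (k * R) q)))) ⟩
      res (i + k * R)                     ≡⟨ proj₂ (divMod-unique (quot i + k * X ∸ 1) x<q k-steps) ⟩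
      x                                   ∎)
      where
      open ≡-Reasoning
      d = q ∸ x
      k = res i + d
      balance : (i + k * R) * p + d ≡ (quot i + k * X) * q
      balance = +-cancelˡ-≡ (res i) _ _ (begin
        res i + ((i + k * R) * p + d)    ≡⟨ x∙yz≈y∙xz (res i) ((i + k * R) * p) d ⟩
        (i + k * R) * p + k              ≡⟨ regroup₁ k ⟩
        i * p + k * (R * p + 1)          ≡⟨ cong₂ (λ z w → z + k * w) (division i) R-step ⟩
        res i + quot i * q + k * (X * q) ≡⟨ regroup₂ (res i) (quot i) k ⟩
        res i + (quot i + k * X) * q     ∎)
        where
        regroup₁ : ∀ u → (i + u * R) * p + u ≡ i * p + u * (R * p + 1)
        regroup₁ u = solve (i ∷ u ∷ R ∷ p ∷ [])
        regroup₂ : ∀ r f u → r + f * q + u * (X * q) ≡ r + (f + u * X) * q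
        regroup₂ r f u = solve (r ∷ f ∷ u ∷ X ∷ q ∷ [])
      k-steps : (i + k * R) * p ≡ x + (quot i + k * X ∸ 1) * q
      k-steps = m+d≡f*n⇒m≡x+[f∸1]*n ((i + k * R) * p) x d q (quot i + k * X)
        (m+[n∸m]≡n (<⇒≤ x<q)) (m<n⇒0<n∸m x<q) balance

    -- Write the w found above as w = u₁ R + u₂ S + v: the u₁ steps of R change the residue by at
    -- most A, the u₂ steps of S by at most A B.
    dense : ∀ i x → x + (A * B + A) < q → ∃[ v ] (v < S × x ≤ res (i + v) × res (i + v) ≤ x + (A * B + A))
    dense i x fits = v , m%n<n w₁ S , lower , upper
      where
      x′ = x + A * B
      x′+A<q : x′ + A < q
      x′+A<q = subst (_< q) (sym (+-assoc x (A * B) A)) fits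
      hit = res-surjective i x′ (≤-<-trans (m≤m+n x′ A) x′+A<q)
      w = proj₁ hit
      u₁ = w / R
      w₁ = w % R
      u₂ = w₁ / S
      v = w₁ % S
      u₁≤A : u₁ ≤ A
      u₁≤A = ≤-pred (m<n*o⇒m/o<n (<-≤-trans (proj₁ (proj₂ hit)) q≤[1+A]R))
      u₂≤B : u₂ ≤ B
      u₂≤B = ≤-pred (m<n*o⇒m/o<n (<-≤-trans (m%n<n w R) R≤[1+B]S))
      u₂A≤AB : u₂ * A ≤ A * B
      u₂A≤AB = ≤-trans (*-monoˡ-≤ A u₂≤B) (≤-reflexive (*-comm B A))
      res-w : res (i + w₁ + u₁ * R) ≡ x′
      res-w = trans (cong res (trans (+-assoc i w₁ (u₁ * R)) (cong (i +_) (sym (m≡m%n+[m/n]*n w R)))))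
                    (proj₂ (proj₂ hit))
      res-w₁ : res (i + w₁) ≡ x′ + u₁
      res-w₁ = trans (res-down (i + w₁) u₁ (subst (λ r → r + u₁ < q) (sym res-w)
                       (≤-<-trans (+-monoʳ-≤ x′ u₁≤A) x′+A<q)))
                     (cong (_+ u₁) res-w)
      res-w₁′ : res (i + v + u₂ * S) ≡ x′ + u₁
      res-w₁′ = trans (cong res (trans (+-assoc i v (u₂ * S)) (cong (i +_) (sym (m≡m%n+[m/n]*n w₁ S))))) res-w₁
      res-v : res (i + v) + u₂ * A ≡ x′ + u₁
      res-v = trans (res-up (i + v) u₂ (subst (u₂ * A ≤_) (sym res-w₁′)
                      (≤-trans u₂A≤AB (≤-trans (m≤n+m (A * B) x) (m≤m+n x′ u₁))))) res-w₁′
      lower : x ≤ res (i + v)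
      lower = +-cancelʳ-≤ (A * B) x (res (i + v)) (begin
        x + A * B            ≤⟨ m≤m+n x′ u₁ ⟩
        x′ + u₁              ≡⟨ res-v ⟨
        res (i + v) + u₂ * A ≤⟨ +-monoʳ-≤ (res (i + v)) u₂A≤AB ⟩
        res (i + v) + A * B  ∎)
        where open ≤-Reasoning
      upper : res (i + v) ≤ x + (A * B + A)
      upper = begin
        res (i + v)          ≤⟨ m≤m+n (res (i + v)) (u₂ * A) ⟩
        res (i + v) + u₂ * A ≡⟨ res-v ⟩
        x′ + u₁              ≤⟨ +-monoʳ-≤ x′ u₁≤A ⟩
        x′ + A               ≡⟨ +-assoc x (A * B) A ⟩
        x + (A * B + A)      ∎
        where open ≤-Reasoning

module Sturmian (pq : ℕ → ℕ) (valid : ValidCF pq) where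
  open Convergents pq valid

  -- Below position q (even j) + q (odd j) the Sturmian word is the rotation word of p₀ / q₀.
  module Prefix (j : ℕ) where
    p₀ q₀ q₁ : ℕ
    p₀ = p (even j)
    q₀ = q (even j)
    q₁ = q (odd j)

    instance
      q₀-nonZero : NonZero q₀
      q₀-nonZero = >-nonZero (q-pos (2 * j))

    open Rotation p₀ q₀ (p≤q (2 * j)) public

    floor-quot : ∀ y → y < q₀ + q₁ → Floor pq y (quot y)
    floor-quot y y< = floor-from-convergent j y (quot y) (res y) (division y) (res<q y) y<

    letterAt-letter : ∀ y → suc y < q₀ + q₁ → LetterAt pq y (letter y)
    letterAt-letter y sy< with quot-suc y
    ... | inj₁ (is-b , same) = inj₁ (is-b , quot y , floor-y , subst (Floor pq (suc y)) same (floor-quot (suc y) sy<))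
      where floor-y = floor-quot y (<-trans (n<1+n y) sy<)
    ... | inj₂ (is-a , step) = inj₂ (is-a , quot y , floor-y , subst (Floor pq (suc y)) step (floor-quot (suc y) sy<))
      where floor-y = floor-quot y (<-trans (n<1+n y) sy<)

    factor-isFactor : ∀ i L → i + L < q₀ + q₁ → IsFactor pq (factor i L)
    factor-isFactor i L i+L< = i , letters i L i+L<
      where
      letters : ∀ i L → i + L < q₀ + q₁ →
                (k : Fin (length (factor i L))) → LetterAt pq (i + toℕ k) (lookup (factor i L) k)
      letters i (suc L) i+L< Fin.zero = subst (λ y → LetterAt pq y (letter i)) (sym (+-identityʳ i))
        (letterAt-letter i (≤-<-trans (subst (suc i ≤_) (sym (+-suc i L)) (s≤s (m≤m+n i L))) i+L<))
      letters i (suc L) i+L< (Fin.suc k) =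
        subst (λ y → LetterAt pq y (lookup (factor (suc i) L) k)) (sym (+-suc i (toℕ k)))
          (letters (suc i) L (subst (_< q₀ + q₁) (+-suc i L) i+L<) k)

  square-of-length-2 : ∃[ w ] (length w ≡ 2 × IsFactor pq w × AbelianSquare w)
  square-of-length-2 = squares (p₀ + p₀ <? q₀)
    where
    open Prefix 2
    R X : ℕ
    R = q (2 * 2)
    X = p (2 * 2)
    R-step : R * p₀ + 1 ≡ X * q₀
    R-step = trans (cong (_+ 1) (*-comm R p₀)) (sym (det-even 2))
    3≤q₀ : 3 ≤ q₀
    3≤q₀ = ≤-trans (s≤s (s≤s (s≤s z≤n))) (q-grows 4)
    squares : Dec (p₀ + p₀ < q₀) → ∃[ w ] (length w ≡ 2 × IsFactor pq w × AbelianSquare w)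
    squares (yes 2p<q) = b ∷ b ∷ [] , refl ,
      subst (IsFactor pq) (factor-bb 2p<q) (factor-isFactor 0 2 (<-≤-trans 3≤q₀ (m≤m+n q₀ q₁))) ,
      abelianSquare-xx b
    squares (no 2p≮q) = a ∷ a ∷ [] , refl ,
      subst (IsFactor pq) (factor-aa R X R-step (≤∧≢⇒< (≮⇒≥ 2p≮q) (q≢p+p R X R-step 3≤q₀)))
        (factor-isFactor R 2 (+-mono-≤-< (q-mono 4) (≤-trans (s≤s (s≤s (s≤s z≤n))) (q-grows 5)))) ,
      abelianSquare-xx a

  ShortSquare : ℕ → List Letter → Set
  ShortSquare n w = length w ≤ n × IsFactor pq w × AbelianSquare w

  module Scale (K : ℕ) (bounded : ∀ i → pq i ≤ K) (s : ℕ) where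
    open Prefix (suc s) public

    R S A B X Y : ℕ
    R = q (2 * suc s)
    S = q (even s)
    A = pq (even s)
    B = pq (2 * s)
    X = p (2 * suc s)
    Y = p (even s)

    instance
      R-nonZero : NonZero R
      R-nonZero = >-nonZero (subst (λ n → 0 < q n) (sym (*-suc 2 s)) (q-pos (even s)))
      S-nonZero : NonZero S
      S-nonZero = >-nonZero (q-pos (2 * s))

    R+S≤q₀ : R + S ≤ q₀
    R+S≤q₀ = subst (λ n → q n + S ≤ q (suc n)) (sym (*-suc 2 s)) (q-+ (even s))

    S≤R : S ≤ R
    S≤R = subst (λ n → S ≤ q n) (sym (*-suc 2 s)) (q-mono (even s))

    S≤q₀ : S ≤ q₀
    S≤q₀ = ≤-trans (m≤n+m S R) R+S≤q₀

    3S≤q₁ : 3 * S ≤ q₁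
    3S≤q₁ = begin
      3 * S     ≡⟨ trans (cong (λ x → S + (S + x)) (+-identityʳ S)) (sym (+-assoc S S S)) ⟩
      S + S + S ≤⟨ +-mono-≤ (+-monoˡ-≤ S S≤R) S≤R ⟩
      R + S + R ≤⟨ +-monoˡ-≤ R R+S≤q₀ ⟩
      q₀ + R    ≤⟨ q-+ (2 * suc s) ⟩
      q₁        ∎
      where open ≤-Reasoning

    open Density R S A B X Y
      (trans (cong (_+ 1) (*-comm R p₀)) (sym (det-even (suc s))))
      (trans (*-comm S p₀) (trans (det-jump-even s) (+-comm (Y * q₀) A)))
      (subst (λ n → q (suc n) ≤ suc A * q n) (sym (*-suc 2 s)) (q-rec-bound (even s)))
      (subst (λ n → q n ≤ suc B * S) (sym (*-suc 2 s)) (q-rec-bound (2 * s)))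

    G H T : ℕ
    G = suc (K * K + K)
    H = q₀ / 3
    T = H / G

    window-step : ∀ t → t * G + (A * B + A) < suc t * G
    window-step t = subst (t * G + (A * B + A) <_) (+-comm (t * G) G)
      (+-monoʳ-< (t * G) (s≤s (+-mono-≤ (*-mono-≤ (bounded _) (bounded _)) (bounded _))))

    window-top : ∀ (t : Fin T) → suc (toℕ t) * G ≤ H
    window-top t = ≤-trans (*-monoˡ-≤ G (toℕ<n t)) (m/n*n≤m H G)

    -- The windows [t G , (t + 1) G), t < T, lie in [0 , H) and are wider than the density gap
    -- A B + A, so each contains the residue of one of any S consecutive positions.
    window : ∀ Z (t : Fin T) → ∃[ v ] (v < S × res (Z + v) < H × res (Z + v) / G ≡ toℕ t)
    window Z t = in-window (dense Z (toℕ t * G) fits)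
      where
      fits : toℕ t * G + (A * B + A) < q₀
      fits = <-≤-trans (window-step (toℕ t)) (≤-trans (window-top t) (m/n≤m q₀ 3))
      in-window : ∃[ v ] (v < S × toℕ t * G ≤ res (Z + v) × res (Z + v) ≤ toℕ t * G + (A * B + A)) →
                  ∃[ v ] (v < S × res (Z + v) < H × res (Z + v) / G ≡ toℕ t)
      in-window (v , v<S , lower , upper) =
        v , v<S , <-≤-trans res<next (window-top t) , k*n≤m<[1+k]*n⇒m/n≡k lower res<next
        where
        res<next : res (Z + v) < suc (toℕ t) * G
        res<next = ≤-<-trans upper (window-step (toℕ t))

    position : ℕ → Fin T → ℕ
    position Z t = Z + proj₁ (window Z t)

    position< : ∀ Z t → position Z t < Z + S
    position< Z t = +-monoʳ-< Z (proj₁ (proj₂ (window Z t)))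

    res-position<H : ∀ Z t → res (position Z t) < H
    res-position<H Z t = proj₁ (proj₂ (proj₂ (window Z t)))

    position-injective : ∀ Z Z′ {t t′} → res (position Z t) ≡ res (position Z′ t′) → t ≡ t′
    position-injective Z Z′ {t} {t′} same-res = toℕ-injective (begin
      toℕ t                  ≡⟨ proj₂ (proj₂ (proj₂ (window Z t))) ⟨
      res (position Z t) / G     ≡⟨ cong (_/ G) same-res ⟩
      res (position Z′ t′) / G   ≡⟨ proj₂ (proj₂ (proj₂ (window Z′ t′))) ⟩
      toℕ t′                 ∎)
      where open ≡-Reasoning

    half start : Fin T → ℕ
    half = position (suc (S / 2))
    start = position (q₀ ∸ S)

    square : Fin T → Fin T → List Letter
    square t u = factor (start t) (half u + half u)

    S≤length : ∀ u → S ≤ half u + half u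
    S≤length u = begin
      S                         ≤⟨ n≤1+n/2+n/2 S ⟩
      suc (S / 2 + S / 2)       ≤⟨ n≤1+n _ ⟩
      suc (suc (S / 2 + S / 2)) ≡⟨ cong suc (+-suc (S / 2) (S / 2)) ⟨
      suc (S / 2) + suc (S / 2) ≤⟨ +-mono-≤ (m≤m+n (suc (S / 2)) _) (m≤m+n (suc (S / 2)) _) ⟩
      half u + half u           ∎
      where open ≤-Reasoning

    length≤3S : ∀ u → half u + half u ≤ 3 * S
    length≤3S u = begin
      half u + half u           ≤⟨ +-mono-≤ half≤ half≤ ⟩
      (S / 2 + S) + (S / 2 + S) ≡⟨ interchange (S / 2) S (S / 2) S ⟩
      (S / 2 + S / 2) + (S + S) ≤⟨ +-monoˡ-≤ (S + S) (n/2+n/2≤n S) ⟩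
      S + (S + S)               ≡⟨ cong (λ x → S + (S + x)) (+-identityʳ S) ⟨
      3 * S                     ∎
      where
      open ≤-Reasoning
      half≤ : half u ≤ S / 2 + S
      half≤ = ≤-pred (position< (suc (S / 2)) u)

    start<q₀ : ∀ t → start t < q₀
    start<q₀ t = subst (start t <_) (m∸n+n≡m S≤q₀) (position< (q₀ ∸ S) t)

    q₀≤end : ∀ t u → q₀ ≤ start t + (half u + half u)
    q₀≤end t u = subst (_≤ start t + (half u + half u)) (m∸n+n≡m S≤q₀)
      (+-mono-≤ (m≤m+n (q₀ ∸ S) (proj₁ (window (q₀ ∸ S) t))) (S≤length u))

    square-short : ∀ n → 3 * S ≤ n → ∀ t u → ShortSquare n (square t u)
    square-short n 3S≤n t u =
        subst (_≤ n) (sym (length-factor (start t) (half u + half u))) (≤-trans (length≤3S u) 3S≤n)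
      , factor-isFactor (start t) (half u + half u) (+-mono-<-≤ (start<q₀ t) (≤-trans (length≤3S u) 3S≤q₁))
      , factor-abelianSquare (start t) (half u) z<s (<-≤-trans
          (+-mono-<-≤ (res-position<H (q₀ ∸ S) t) (+-mono-≤ (<⇒≤ res-half<H) (<⇒≤ res-half<H)))
          (subst (_≤ q₀) H*3≡H+H+H (m/n*n≤m q₀ 3)))
      where
      res-half<H = res-position<H (suc (S / 2)) u
      H*3≡H+H+H : H * 3 ≡ H + (H + H)
      H*3≡H+H+H = trans (*-comm H 3) (cong (λ x → H + (H + x)) (+-identityʳ H))

    square-injective : ∀ {t t′ u u′} → square t u ≡ square t′ u′ → t ≡ t′ × u ≡ u′
    square-injective {t} {t′} {u} {u′} same = position-injective (q₀ ∸ S) (q₀ ∸ S) same-res ,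
                                              position-injective (suc (S / 2)) (suc (S / 2)) (cong res same-half)
      where
      same-half : half u ≡ half u′
      same-half = m+m≡n+n⇒m≡n
        (trans (sym (length-factor (start t) _)) (trans (cong length same) (length-factor (start t′) _)))
      L = half u + half u
      same′ : factor (start t) L ≡ factor (start t′) L
      same′ = trans same (cong (λ m → factor (start t′) (m + m)) (sym same-half))
      same-res : res (start t) ≡ res (start t′)
      same-res = ≤-antisym (factor-≡⇒res-≤ (start t′) (start t) L (start<q₀ t) (q₀≤end t u) (sym same′))
                           (factor-≡⇒res-≤ (start t) (start t′) L (start<q₀ t′) (q₀≤end t′ u) same′)

    squares : List (List Letter)
    squares = cartesianProductWith square (allFin T) (allFin T)

    squares-unique : Unique squares
    squares-unique =
      Uniqueₚ.cartesianProductWith⁺ square square-injective (Uniqueₚ.allFin⁺ T) (Uniqueₚ.allFin⁺ T)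

    squares-short : ∀ n → 3 * S ≤ n → All (ShortSquare n) squares
    squares-short n 3S≤n = Allₚ.cartesianProductWith⁺ (setoid (Fin T)) (setoid (Fin T)) square
      (allFin T) (allFin T) (λ {t} {u} _ _ → square-short n 3S≤n t u)

    length-squares : length squares ≡ T * T
    length-squares = trans (length-cartesianProductWith square (allFin T) (allFin T))
                           (cong₂ _*_ (length-tabulate {n = T} id) (length-tabulate {n = T} id))

    scale-bound : 3 * q₀ ≤ 9 * G * suc T
    scale-bound = begin
      3 * q₀              ≤⟨ *-monoʳ-≤ 3 (<⇒≤ q₀<[1+T]G*3) ⟩
      3 * (suc T * G * 3) ≡⟨ regroup G T ⟩
      9 * G * suc T       ∎
      where
      open ≤-Reasoning
      q₀<[1+T]G*3 : q₀ < suc T * G * 3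
      q₀<[1+T]G*3 = <-≤-trans (m<suc[m/n]*n q₀ 3) (*-monoˡ-≤ 3 (m<suc[m/n]*n H G))
      regroup : ∀ g t → 3 * (suc t * g * 3) ≡ 9 * g * suc t
      regroup g t = solve (g ∷ t ∷ [])

  scale-squares : ∀ K → (∀ i → pq i ≤ K) → ∀ n → 3 ≤ n →
    ∃[ T ] (n < 9 * suc (K * K + K) * suc T × ∃[ L ] (Unique L × All (ShortSquare n) L × length L ≡ T * T))
  scale-squares K bounded n 3≤n with threshold (λ s → 3 * q (even s) ≤? n) 3≤n n (<⇒≱ n<3q)
    where
    n<3q : n < 3 * q (even n)
    n<3q = ≤-<-trans (≤-trans (m≤m+n n (n + 0)) (q-grows (2 * n)))
                     (m<m+n (q (even n)) (≤-trans (q-pos (2 * n)) (m≤m+n _ _)))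
  ... | s , 3S≤n , 3q₀≰n = T , <-≤-trans (≰⇒> 3q₀≰n) scale-bound ,
                           squares , squares-unique , squares-short n 3S≤n , length-squares
    where open Scale K bounded s

  SquareFamily : ℕ → ℕ → Set
  SquareFamily C n = ∃[ T ] (n < C * suc T ×
    ∃[ L ] (Unique L × All (ShortSquare n) L × T * T ≤ length L × 0 < length L))

  singleton-family : ∀ C {n} → 2 ≤ n → n < C * 1 → SquareFamily C n
  singleton-family C {n} 2≤n n<C with square-of-length-2
  ... | w , |w|≡2 , w-factor , w-square =
    0 , n<C , w ∷ [] , [] ∷ [] , (subst (_≤ n) (sym |w|≡2) 2≤n , w-factor , w-square) ∷ [] , z≤n , z<s
    where
    open All using ([]; _∷_)
    open AllPairs using ([]; _∷_)

  square-family : ∀ K → (∀ i → pq i ≤ K) → ∀ n → 2 ≤ n → SquareFamily (9 * suc (K * K + K)) n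
  square-family K bounded n 2≤n with 3 ≤? n
  ... | no 3≰n  = singleton-family C 2≤n (<-≤-trans (≰⇒> 3≰n)
    (≤-trans (s≤s (s≤s (s≤s z≤n))) (≤-trans (m≤m*n 9 (suc (K * K + K))) (m≤m*n C 1))))
    where C = 9 * suc (K * K + K)
  ... | yes 3≤n = from-scale (scale-squares K bounded n 3≤n)
    where
    C = 9 * suc (K * K + K)
    from-scale : ∃[ T ] (n < C * suc T × ∃[ L ] (Unique L × All (ShortSquare n) L × length L ≡ T * T)) →
                 SquareFamily C n
    from-scale (zero , n<C , _) = singleton-family C 2≤n n<C
    from-scale (suc T , n<C[1+T] , L , unique , short , |L|≡T²) =
      suc T , n<C[1+T] , L , unique , short , ≤-reflexive (sym |L|≡T²) , subst (0 <_) (sym |L|≡T²) z<s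

theorem18 : (pq : ℕ → ℕ) → ValidCF pq → BoundedPQ pq →
    ∃[ c ] ∃[ d ] (0 < c × 0 < d ×
      (∀ (n : ℕ) → 2 ≤ n →
        ∃[ L ] (Unique L ×
          All (λ w → length w ≤ n × IsFactor pq w × AbelianSquare w) L ×
          c * (n * n) ≤ d * length L)))
theorem18 pq valid (K , bounded) = 1 , 4 * (C * C) , z<s , z<s , λ n 2≤n → quadratic (square-family K bounded n 2≤n)
  where
  open Sturmian pq valid
  C : ℕ
  C = 9 * suc (K * K + K)
  quadratic : ∀ {n} → SquareFamily C n →
              ∃[ L ] (Unique L × All (ShortSquare n) L × 1 * (n * n) ≤ 4 * (C * C) * length L)
  quadratic {n} (T , n<C[1+T] , L , unique , short , T²≤|L| , 0<|L|) = L , unique , short ,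
    subst (_≤ 4 * (C * C) * length L) (sym (*-identityˡ (n * n))) (square-bound n C T (length L) n<C[1+T] T²≤|L| 0<|L|)
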